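{- Let $n\ge1$, $k$, $p$, $N$ and the Hecke operators $\widetilde T_r(p^2)$, $T'_q(p^2)$ be as in the context. Then for $1\le r\le n$, $$\widetilde T_r(p^2)=\sum_{0\le q\le r}\beta(n-q,r-q)\,T'_q(p^2).$$
   Context: $p$ is a prime, $k,n$ positive integers, and the operators act on Siegel modular forms of degree $n$, weight $k$, level $N$ with $p\nmid N$. $\mu(m,r)=\prod_{i=0}^{r-1}(p^{m-i}-1)$, $\beta(m,r)=\mu(m,r)/\mu(r,r)$, $=1$ for $r=0$. With $\Gamma=\Gamma_1(N)$, $F|T_j(p^2)=\sum_{\gamma\in(\Gamma\cap\delta_0\Gamma\delta_0^{ -1})\backslash\Gamma}F|\delta_0^{ -1}\gamma$ (weight $k$ slash action), $\delta_0=\mathrm{diag}(pI_j,I_{n-j},\frac1pI_j,I_{n-j})$, $1\le j\le n$; $T_0(p^2)$ is the identity. $\widetilde T_j(p^2)=p^{j(k-n-1)}\sum_{0\le\ell\le j}\beta(n-\ell,j-\ell)T_\ell(p^2)$ and $T'_j(p^2)=\sum_{0\le q\le j}(-1)^qp^{q(q-1)/2}\beta(n-j+q,q)\,\widetilde T_{j-q}(p^2)$ for $0\le j\le n$. -}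

module Defs where

open import Data.Nat as ℕ using (ℕ; zero; suc)
open import Data.Nat.DivMod using (_/_)
open import Data.Integer as ℤ using (ℤ; +_; -[1+_])
open import Algebra.Bundles using (Ring)

μ : ℕ → ℕ → ℕ → ℕ
μ p m zero    = 1
μ p m (suc r) = μ p m r ℕ.* (p ℕ.^ (m ℕ.∸ r) ℕ.∸ 1)

-- natural-number division, with the (never used) convention a / 0 = 0
divℕ : ℕ → ℕ → ℕ
divℕ a zero    = 0
divℕ a (suc b) = a / suc b

β : ℕ → ℕ → ℕ → ℕ
β p m r = divℕ (μ p m r) (μ p r r)

-- Operations in a ring R of operators (e.g. the endomorphism ring of the
-- space of Siegel modular forms), where P is the scalar p and Pinv its inverse.
module RingOps {c ℓ} (R : Ring c ℓ) where
  open Ring R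

  ι : ℕ → Carrier
  ι zero    = 0#
  ι (suc n) = 1# + ι n

  pow : Carrier → ℕ → Carrier
  pow x zero    = 1#
  pow x (suc n) = x * pow x n

  zpow : Carrier → Carrier → ℤ → Carrier
  zpow P Pinv (+ n)      = pow P n
  zpow P Pinv -[1+ n ]   = pow Pinv (suc n)

  Σ≤ : ℕ → (ℕ → Carrier) → Carrier
  Σ≤ zero    f = f 0
  Σ≤ (suc r) f = Σ≤ r f + f (suc r)

  Ttilde : (p k n : ℕ) (P Pinv : Carrier) (T : ℕ → Carrier) → ℕ → Carrier
  Ttilde p k n P Pinv T j =
    zpow P Pinv (+ (j ℕ.* k) ℤ.- + (j ℕ.* (n ℕ.+ 1)))
      * Σ≤ j (λ l → ι (β p (n ℕ.∸ l) (j ℕ.∸ l)) * T l)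

  T′ : (p k n : ℕ) (P Pinv : Carrier) (T : ℕ → Carrier) → ℕ → Carrier
  T′ p k n P Pinv T j =
    Σ≤ j (λ q → pow (- 1#) q * ι (p ℕ.^ divℕ (q ℕ.* (q ℕ.∸ 1)) 2)
                  * ι (β p (n ℕ.∸ j ℕ.+ q) q) * Ttilde p k n P Pinv T (j ℕ.∸ q))

module Submission where

open import Defs
open import Data.Nat using (ℕ; _≤_; _∸_)
open import Data.Nat.Divisibility using (_∣_)
open import Data.Nat.Primality using (Prime)
open import Relation.Nullary using (¬_)
open import Algebra.Bundles using (Ring)

-- The identity is an inversion formula for triangular Gaussian-binomial
-- transforms, valid for an arbitrary sequence X in place of T̃.  Writing [a b] for the Gaussian binomial
-- coefficient at p, one has β(a,b) = [a b] for p > 1.  Substituting the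
-- definition of T'_q into the right-hand side and regrouping the double sum
-- along antidiagonals, the coefficient of X_m becomes
--     Σ_s β(n-m-s, r-m-s) (-1)^s p^{s(s-1)/2} β(n-m, s)
--       = [n-m r-m] · Σ_s (-1)^s p^{s(s-1)/2} [r-m s],
-- by the "subset of a subset" identity [a-s d-s][a s] = [a d][d s].
-- The remaining alternating sum is the p-binomial theorem at x = -1: it is
-- 1 for r = m and telescopes to 0 for r > m, so only X_r survives.

open import Data.Nat using (zero; suc)
import Data.Nat as ℕ
import Data.Nat.Properties as ℕₚ
import Relation.Binary.PropositionalEquality as ≡
open import Data.Nat.Primality using (prime⇒nonTrivial)

module GaussianBinomial (p : ℕ) (1<p : 1 ℕ.< p) where
  open import Data.Nat
  open import Data.Nat.Properties
  open import Data.Nat.DivMod using (_/_; m*n/n≡m; +-distrib-/-∣ʳ)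
  open import Data.Nat.Divisibility using (divides)
  open import Data.Nat.Tactic.RingSolver using (solve-∀)
  open import Relation.Binary.PropositionalEquality
  open import Relation.Nullary using (yes; no)
  open ≡-Reasoning

  instance
    p≢0 : NonZero p
    p≢0 = >-nonZero (<-trans z<s 1<p)

  qbinom : ℕ → ℕ → ℕ
  qbinom a       zero    = 1
  qbinom zero    (suc b) = 0
  qbinom (suc a) (suc b) = qbinom a b + p ^ suc b * qbinom a (suc b)

  qbinom-vanish : ∀ {a b} → a < b → qbinom a b ≡ 0
  qbinom-vanish {zero}  {suc b} _ = refl
  qbinom-vanish {suc a} {suc b} (s≤s a<b)
    rewrite qbinom-vanish a<b | qbinom-vanish (m<n⇒m<1+n a<b) = *-zeroʳ (p ^ suc b)

  -- μ(a,b) has the factor p^0 - 1 = 0 as soon as b > a.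
  μ-vanish : ∀ {a b} → a < b → μ p a b ≡ 0
  μ-vanish {a} {suc b} (s≤s a≤b) = begin
    μ p a b * (p ^ (a ∸ b) ∸ 1) ≡⟨ cong (λ e → μ p a b * (p ^ e ∸ 1)) (m≤n⇒m∸n≡0 a≤b) ⟩
    μ p a b * 0                 ≡⟨ *-zeroʳ (μ p a b) ⟩
    0                           ∎

  μ-step : ∀ a b → μ p (suc a) (suc b) ≡ (p ^ suc a ∸ 1) * μ p a b
  μ-step a zero    = trans (*-identityˡ _) (sym (*-identityʳ _))
  μ-step a (suc b) rewrite μ-step a b = *-assoc (p ^ suc a ∸ 1) (μ p a b) _

  pow∸1-+ : ∀ m n → p ^ (m + n) ∸ 1 ≡ (p ^ m ∸ 1) + p ^ m * (p ^ n ∸ 1)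
  pow∸1-+ m n = trans (cong (_∸ 1) (^-distribˡ-+-* p m n))
                      (split (p ^ m) (p ^ n) (m^n>0 p m) (m^n>0 p n))
    where
    split : ∀ x y → 0 < x → 0 < y → x * y ∸ 1 ≡ (x ∸ 1) + x * (y ∸ 1)
    split (suc x) (suc y) _ _ = lemma x y
      where
      lemma : ∀ x y → y + x * suc y ≡ x + suc x * y
      lemma = solve-∀

  μ≡qbinom*μ : ∀ a b → μ p a b ≡ qbinom a b * μ p b b
  μ≡qbinom*μ a       zero    = refl
  μ≡qbinom*μ zero    (suc b) = μ-vanish {0} {suc b} z<s
  μ≡qbinom*μ (suc a) (suc b) with b ≤? a
  ... | no b≰a = trans (μ-vanish (s≤s (≰⇒> b≰a)))
                       (sym (cong (_* μ p (suc b) (suc b)) (qbinom-vanish (s≤s (≰⇒> b≰a)))))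
  ... | yes b≤a = begin
    μ p (suc a) (suc b)                              ≡⟨ μ-step a b ⟩
    (p ^ suc a ∸ 1) * μ p a b                        ≡⟨ cong (λ e → (p ^ suc e ∸ 1) * μ p a b) (sym (m+[n∸m]≡n b≤a)) ⟩
    (p ^ (suc b + (a ∸ b)) ∸ 1) * μ p a b            ≡⟨ cong (_* μ p a b) (pow∸1-+ (suc b) (a ∸ b)) ⟩
    (E + Q * (p ^ (a ∸ b) ∸ 1)) * μ p a b            ≡⟨ expand E Q (p ^ (a ∸ b) ∸ 1) (μ p a b) ⟩
    E * μ p a b + Q * μ p a (suc b)                  ≡⟨ cong₂ (λ x y → E * x + Q * y) (μ≡qbinom*μ a b) (μ≡qbinom*μ a (suc b)) ⟩
    E * (qbinom a b * M) + Q * (qbinom a (suc b) * μ p (suc b) (suc b))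
                                                     ≡⟨ cong (λ x → E * (qbinom a b * M) + Q * (qbinom a (suc b) * x)) (μ-step b b) ⟩
    E * (qbinom a b * M) + Q * (qbinom a (suc b) * (E * M))
                                                     ≡⟨ collect E Q (qbinom a b) (qbinom a (suc b)) M ⟩
    qbinom (suc a) (suc b) * (E * M)                 ≡⟨ cong (qbinom (suc a) (suc b) *_) (sym (μ-step b b)) ⟩
    qbinom (suc a) (suc b) * μ p (suc b) (suc b)     ∎
    where
    E = p ^ suc b ∸ 1
    Q = p ^ suc b
    M = μ p b b
    expand : ∀ e q f m → (e + q * f) * m ≡ e * m + q * (m * f)
    expand = solve-∀
    collect : ∀ e q g h m → e * (g * m) + q * (h * (e * m)) ≡ (g + q * h) * (e * m)
    collect = solve-∀

  -- For p > 1 every factor p^{a-i} - 1 with i < a is nonzero.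
  μ-nonZero : ∀ a i → i ≤ a → NonZero (μ p a i)
  μ-nonZero a zero    _   = _
  μ-nonZero a (suc i) i<a = m*n≢0 (μ p a i) (p ^ (a ∸ i) ∸ 1)
    {{μ-nonZero a i (<⇒≤ i<a)}} {{>-nonZero (∸-monoˡ-≤ 1 (^-monoʳ-< p 1<p (m<n⇒0<n∸m i<a)))}}

  β≡qbinom : ∀ a b → β p a b ≡ qbinom a b
  β≡qbinom a b = trans (cong (λ x → divℕ x (μ p b b)) (μ≡qbinom*μ a b))
                       (cancel (qbinom a b) (μ p b b) {{μ-nonZero b b ≤-refl}})
    where
    cancel : ∀ g m .{{_ : NonZero m}} → divℕ (g * m) m ≡ g
    cancel g (suc m) = m*n/n≡m g (suc m)

  μ-split : ∀ a j k → μ p a (j + k) ≡ μ p a j * μ p (a ∸ j) k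
  μ-split a j zero    rewrite +-identityʳ j = sym (*-identityʳ _)
  μ-split a j (suc k) rewrite +-suc j k | μ-split a j k | ∸-+-assoc a j k =
    *-assoc (μ p a j) (μ p (a ∸ j) k) _

  -- "Subset of a subset": [a-j d-j][a j] = [a d][d j]; both sides times
  -- μ(d-j,d-j) μ(j,j) equal μ(a,d).
  qbinom-nested : ∀ a {d j} → j ≤ d → qbinom (a ∸ j) (d ∸ j) * qbinom a j ≡ qbinom a d * qbinom d j
  qbinom-nested a {d} {j} j≤d =
    *-cancelʳ-≡ _ _ (μ p k k * μ p j j)
      {{m*n≢0 _ _ {{μ-nonZero k k ≤-refl}} {{μ-nonZero j j ≤-refl}}}} (trans lhs (sym rhs))
    where
    k = d ∸ j
    j+k≡d : j + k ≡ d
    j+k≡d = m+[n∸m]≡n j≤d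
    regroup : ∀ x y u v → (x * y) * (u * v) ≡ (x * u) * (y * v)
    regroup = solve-∀
    regroup′ : ∀ x y u v → (x * y) * (u * v) ≡ x * ((y * v) * u)
    regroup′ = solve-∀
    lhs : qbinom (a ∸ j) k * qbinom a j * (μ p k k * μ p j j) ≡ μ p a d
    lhs = begin
      qbinom (a ∸ j) k * qbinom a j * (μ p k k * μ p j j)     ≡⟨ regroup (qbinom (a ∸ j) k) (qbinom a j) (μ p k k) (μ p j j) ⟩
      (qbinom (a ∸ j) k * μ p k k) * (qbinom a j * μ p j j)   ≡⟨ sym (cong₂ _*_ (μ≡qbinom*μ (a ∸ j) k) (μ≡qbinom*μ a j)) ⟩
      μ p (a ∸ j) k * μ p a j                                 ≡⟨ *-comm (μ p (a ∸ j) k) (μ p a j) ⟩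
      μ p a j * μ p (a ∸ j) k                                 ≡⟨ sym (μ-split a j k) ⟩
      μ p a (j + k)                                           ≡⟨ cong (μ p a) j+k≡d ⟩
      μ p a d                                                 ∎
    rhs : qbinom a d * qbinom d j * (μ p k k * μ p j j) ≡ μ p a d
    rhs = begin
      qbinom a d * qbinom d j * (μ p k k * μ p j j)           ≡⟨ regroup′ (qbinom a d) (qbinom d j) (μ p k k) (μ p j j) ⟩
      qbinom a d * ((qbinom d j * μ p j j) * μ p k k)         ≡⟨ cong (λ x → qbinom a d * (x * μ p k k)) (sym (μ≡qbinom*μ d j)) ⟩
      qbinom a d * (μ p d j * μ p (d ∸ j) k)                  ≡⟨ cong (qbinom a d *_) (sym (μ-split d j k)) ⟩
      qbinom a d * μ p d (j + k)                              ≡⟨ cong (λ x → qbinom a d * μ p d x) j+k≡d ⟩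
      qbinom a d * μ p d d                                    ≡⟨ sym (μ≡qbinom*μ a d) ⟩
      μ p a d                                                 ∎

  -- The product of β-coefficients met in the coefficient of X_m.
  β-product : ∀ {a d s} → s ≤ d → d ≤ a → ∀ x →
    β p (a ∸ s) (d ∸ s) * (x * β p (a ∸ s + s) s) ≡ qbinom a d * (x * qbinom d s)
  β-product {a} {d} {s} s≤d d≤a x = begin
    β p (a ∸ s) (d ∸ s) * (x * β p (a ∸ s + s) s)    ≡⟨ cong (λ t → β p (a ∸ s) (d ∸ s) * (x * β p t s)) (m∸n+n≡m (≤-trans s≤d d≤a)) ⟩
    β p (a ∸ s) (d ∸ s) * (x * β p a s)              ≡⟨ cong₂ (λ u v → u * (x * v)) (β≡qbinom (a ∸ s) (d ∸ s)) (β≡qbinom a s) ⟩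
    qbinom (a ∸ s) (d ∸ s) * (x * qbinom a s)        ≡⟨ swap (qbinom (a ∸ s) (d ∸ s)) x (qbinom a s) ⟩
    x * (qbinom (a ∸ s) (d ∸ s) * qbinom a s)        ≡⟨ cong (x *_) (qbinom-nested a s≤d) ⟩
    x * (qbinom a d * qbinom d s)                    ≡⟨ swap x (qbinom a d) (qbinom d s) ⟩
    qbinom a d * (x * qbinom d s)                    ∎
    where
    swap : ∀ u v w → u * (v * w) ≡ v * (u * w)
    swap = solve-∀

  triangle : ℕ → ℕ
  triangle s = divℕ (s * (s ∸ 1)) 2

  triangle-suc : ∀ s → triangle (suc s) ≡ triangle s + s
  triangle-suc s = begin
    suc s * s / 2                   ≡⟨ cong (_/ 2) (double s) ⟩
    (s * (s ∸ 1) + s * 2) / 2       ≡⟨ +-distrib-/-∣ʳ (s * (s ∸ 1)) (divides s refl) ⟩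
    s * (s ∸ 1) / 2 + s * 2 / 2     ≡⟨ cong (s * (s ∸ 1) / 2 +_) (m*n/n≡m s 2) ⟩
    triangle s + s                  ∎
    where
    double : ∀ s → suc s * s ≡ s * (s ∸ 1) + s * 2
    double zero    = refl
    double (suc s) = lemma s
      where
      lemma : ∀ s → suc (suc s) * suc s ≡ suc s * s + suc s * 2
      lemma = solve-∀

  weight : ℕ → ℕ → ℕ
  weight d j = p ^ triangle j * (p ^ j * qbinom d j)

  weight-pascal : ∀ d j → p ^ triangle (suc j) * qbinom (suc d) (suc j) ≡ weight d j + weight d (suc j)
  weight-pascal d j = begin
    p ^ triangle (suc j) * (qbinom d j + B)                      ≡⟨ *-distribˡ-+ (p ^ triangle (suc j)) (qbinom d j) B ⟩
    p ^ triangle (suc j) * qbinom d j + p ^ triangle (suc j) * B  ≡⟨ cong (λ e → e * qbinom d j + p ^ triangle (suc j) * B) pow-triangle ⟩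
    p ^ triangle j * p ^ j * qbinom d j + weight d (suc j)       ≡⟨ cong (_+ weight d (suc j)) (*-assoc (p ^ triangle j) (p ^ j) (qbinom d j)) ⟩
    weight d j + weight d (suc j)                                ∎
    where
    B = p ^ suc j * qbinom d (suc j)
    pow-triangle : p ^ triangle (suc j) ≡ p ^ triangle j * p ^ j
    pow-triangle = trans (cong (p ^_) (triangle-suc j)) (^-distribˡ-+-* p (triangle j) j)

module FiniteSums {c ℓ} (R : Ring c ℓ) where
  open Ring R
  open RingOps R
  open import Relation.Binary.Reasoning.Setoid setoid

  Σ-cong : ∀ r {f g : ℕ → Carrier} → (∀ i → i ≤ r → f i ≈ g i) → Σ≤ r f ≈ Σ≤ r g
  Σ-cong zero    f≈g = f≈g 0 ℕ.z≤n
  Σ-cong (suc r) f≈g = +-cong (Σ-cong r (λ i i≤r → f≈g i (ℕₚ.m≤n⇒m≤1+n i≤r))) (f≈g (suc r) ℕₚ.≤-refl)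

  Σ-first : ∀ r (f : ℕ → Carrier) → Σ≤ (suc r) f ≈ f 0 + Σ≤ r (λ i → f (suc i))
  Σ-first zero    f = refl
  Σ-first (suc r) f = trans (+-congʳ (Σ-first r f)) (+-assoc _ _ _)

  Σ-reverse : ∀ r (f : ℕ → Carrier) → Σ≤ r f ≈ Σ≤ r (λ i → f (r ∸ i))
  Σ-reverse zero    f = refl
  Σ-reverse (suc r) f = begin
    Σ≤ r f + f (suc r)                     ≈⟨ +-congʳ (Σ-reverse r f) ⟩
    Σ≤ r (λ i → f (r ∸ i)) + f (suc r)     ≈⟨ +-comm _ _ ⟩
    f (suc r) + Σ≤ r (λ i → f (r ∸ i))     ≈⟨ sym (Σ-first r (λ i → f (suc r ∸ i))) ⟩
    Σ≤ (suc r) (λ i → f (suc r ∸ i))       ∎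

  Σ-*ˡ : ∀ r x (f : ℕ → Carrier) → x * Σ≤ r f ≈ Σ≤ r (λ i → x * f i)
  Σ-*ˡ zero    x f = refl
  Σ-*ˡ (suc r) x f = trans (distribˡ x _ _) (+-congʳ (Σ-*ˡ r x f))

  Σ-*ʳ : ∀ r x (f : ℕ → Carrier) → Σ≤ r f * x ≈ Σ≤ r (λ i → f i * x)
  Σ-*ʳ zero    x f = refl
  Σ-*ʳ (suc r) x f = trans (distribʳ x _ _) (+-congʳ (Σ-*ʳ r x f))

  Σ-+ : ∀ r (f g : ℕ → Carrier) → Σ≤ r (λ i → f i + g i) ≈ Σ≤ r f + Σ≤ r g
  Σ-+ zero    f g = refl
  Σ-+ (suc r) f g = begin
    Σ≤ r (λ i → f i + g i) + (f (suc r) + g (suc r))    ≈⟨ +-congʳ (Σ-+ r f g) ⟩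
    (Σ≤ r f + Σ≤ r g) + (f (suc r) + g (suc r))         ≈⟨ +-assoc _ _ _ ⟩
    Σ≤ r f + (Σ≤ r g + (f (suc r) + g (suc r)))         ≈⟨ +-congˡ (sym (+-assoc _ _ _)) ⟩
    Σ≤ r f + ((Σ≤ r g + f (suc r)) + g (suc r))         ≈⟨ +-congˡ (+-congʳ (+-comm _ _)) ⟩
    Σ≤ r f + ((f (suc r) + Σ≤ r g) + g (suc r))         ≈⟨ +-congˡ (+-assoc _ _ _) ⟩
    Σ≤ r f + (f (suc r) + Σ≤ (suc r) g)                 ≈⟨ sym (+-assoc _ _ _) ⟩
    Σ≤ (suc r) f + Σ≤ (suc r) g                         ∎

  Σ-telescope : ∀ r (u : ℕ → Carrier) → Σ≤ r (λ i → - u i + u (suc i)) ≈ - u 0 + u (suc r)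
  Σ-telescope zero    u = refl
  Σ-telescope (suc r) u = begin
    Σ≤ r (λ i → - u i + u (suc i)) + (- u (suc r) + u (suc (suc r)))  ≈⟨ +-congʳ (Σ-telescope r u) ⟩
    (- u 0 + u (suc r)) + (- u (suc r) + u (suc (suc r)))             ≈⟨ +-assoc _ _ _ ⟩
    - u 0 + (u (suc r) + (- u (suc r) + u (suc (suc r))))             ≈⟨ +-congˡ (sym (+-assoc _ _ _)) ⟩
    - u 0 + ((u (suc r) + - u (suc r)) + u (suc (suc r)))             ≈⟨ +-congˡ (+-congʳ (-‿inverseʳ _)) ⟩
    - u 0 + (0# + u (suc (suc r)))                                    ≈⟨ +-congˡ (+-identityˡ _) ⟩
    - u 0 + u (suc (suc r))                                           ∎

  Σ-last : ∀ r (f : ℕ → Carrier) → (∀ i → i ℕ.< r → f i ≈ 0#) → Σ≤ r f ≈ f r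
  Σ-last zero    f _  = refl
  Σ-last (suc r) f f≈0 = trans (+-congʳ Σ≈0) (+-identityˡ _)
    where
    Σ≈0 : Σ≤ r f ≈ 0#
    Σ≈0 = trans (Σ-last r f (λ i i<r → f≈0 i (ℕₚ.m<n⇒m<1+n i<r))) (f≈0 r (ℕₚ.n<1+n r))

  antidiagonal : ∀ r (H : ℕ → ℕ → Carrier) →
    Σ≤ r (λ q → Σ≤ q (λ s → H (q ∸ s) s)) ≈ Σ≤ r (λ m → Σ≤ (r ∸ m) (H m))
  antidiagonal zero    H = refl
  antidiagonal (suc r) H = begin
    Σ≤ r (λ q → Σ≤ q (λ s → H (q ∸ s) s)) + Σ≤ (suc r) (λ s → H (suc r ∸ s) s)
      ≈⟨ +-cong (antidiagonal r H) (diagonal (suc r)) ⟩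
    Σ≤ r (λ m → Σ≤ (r ∸ m) (H m)) + (Σ≤ r (λ m → H m (suc r ∸ m)) + H (suc r) (r ∸ r))
      ≈⟨ sym (+-assoc _ _ _) ⟩
    (Σ≤ r (λ m → Σ≤ (r ∸ m) (H m)) + Σ≤ r (λ m → H m (suc r ∸ m))) + H (suc r) (r ∸ r)
      ≈⟨ +-cong (sym (Σ-+ r _ _)) (reflexive (≡.cong (H (suc r)) (ℕₚ.n∸n≡0 r))) ⟩
    Σ≤ r (λ m → Σ≤ (r ∸ m) (H m) + H m (suc r ∸ m)) + H (suc r) 0
      ≈⟨ +-cong (Σ-cong r extend) (reflexive (≡.cong (λ t → Σ≤ t (H (suc r))) (≡.sym (ℕₚ.n∸n≡0 r)))) ⟩
    Σ≤ r (λ m → Σ≤ (suc r ∸ m) (H m)) + Σ≤ (r ∸ r) (H (suc r))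
      ∎
    where
    diagonal : ∀ q → Σ≤ q (λ s → H (q ∸ s) s) ≈ Σ≤ q (λ m → H m (q ∸ m))
    diagonal q = trans (Σ-reverse q _)
      (Σ-cong q (λ m m≤q → reflexive (≡.cong (λ t → H t (q ∸ m)) (ℕₚ.m∸[m∸n]≡n m≤q))))
    extend : ∀ m → m ≤ r → Σ≤ (r ∸ m) (H m) + H m (suc r ∸ m) ≈ Σ≤ (suc r ∸ m) (H m)
    extend m m≤r rewrite ℕₚ.+-∸-assoc 1 m≤r = refl

-- Integer scalars in a ring: the image ι n of a natural number and the sign
-- (-1)^s.  Both commute with everything, which is all the non-commutative
-- ring needs for the coefficient computations.
module Scalars {c ℓ} (R : Ring c ℓ) where
  open Ring R
  open RingOps R
  open import Relation.Binary.Reasoning.Setoid setoid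
  open import Algebra.Properties.Semiring.Mult semiring using (_×_; ×-homo-+; ×1-homo-*; ×-comm-*; ×-assoc-*; ×-congʳ)
  open import Algebra.Properties.Ring R using (-1*x≈-x)

  sign : ℕ → Carrier
  sign s = pow (- 1#) s

  ι≈× : ∀ n → ι n ≈ n × 1#
  ι≈× zero    = refl
  ι≈× (suc n) = +-congˡ (ι≈× n)

  ι-+ : ∀ m n → ι (m ℕ.+ n) ≈ ι m + ι n
  ι-+ m n = trans (ι≈× (m ℕ.+ n)) (trans (×-homo-+ 1# m n) (sym (+-cong (ι≈× m) (ι≈× n))))

  ι-* : ∀ m n → ι (m ℕ.* n) ≈ ι m * ι n
  ι-* m n = trans (ι≈× (m ℕ.* n)) (trans (×1-homo-* m n) (sym (*-cong (ι≈× m) (ι≈× n))))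

  ι-central : ∀ n x → ι n * x ≈ x * ι n
  ι-central n x = begin
    ι n * x          ≈⟨ *-congʳ (ι≈× n) ⟩
    (n × 1#) * x     ≈⟨ ×-assoc-* n 1# x ⟩
    n × (1# * x)     ≈⟨ ×-congʳ n (trans (*-identityˡ x) (sym (*-identityʳ x))) ⟩
    n × (x * 1#)     ≈⟨ sym (×-comm-* n x 1#) ⟩
    x * (n × 1#)     ≈⟨ *-congˡ (sym (ι≈× n)) ⟩
    x * ι n          ∎

  ι-into-signed : ∀ x s y → ι x * (sign s * ι y) ≈ sign s * ι (x ℕ.* y)
  ι-into-signed x s y = begin
    ι x * (sign s * ι y)   ≈⟨ sym (*-assoc _ _ _) ⟩
    (ι x * sign s) * ι y   ≈⟨ *-congʳ (ι-central x (sign s)) ⟩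
    (sign s * ι x) * ι y   ≈⟨ *-assoc _ _ _ ⟩
    sign s * (ι x * ι y)   ≈⟨ *-congˡ (sym (ι-* x y)) ⟩
    sign s * ι (x ℕ.* y)   ∎

  sign-suc : ∀ s x → sign (suc s) * x ≈ - (sign s * x)
  sign-suc s x = trans (*-assoc _ _ _) (-1*x≈-x (sign s * x))

module Inversion {c ℓ} (R : Ring c ℓ) (p n : ℕ) (1<p : 1 ℕ.< p) where
  open Ring R
  open RingOps R
  open FiniteSums R
  open Scalars R
  open GaussianBinomial p 1<p
  open import Relation.Binary.Reasoning.Setoid setoid

  alternating : ℕ → Carrier
  alternating d = Σ≤ d (λ j → sign j * ι (p ℕ.^ triangle j ℕ.* qbinom d j))

  alternating-zero : alternating 0 ≈ 1#
  alternating-zero = trans (*-identityˡ _) (+-identityʳ _)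

  -- For d ≥ 1 the weighted p-Pascal rule makes the sum telescope to 0.
  alternating-suc : ∀ d → alternating (suc d) ≈ 0#
  alternating-suc d = begin
    alternating (suc d)                        ≈⟨ Σ-first d _ ⟩
    u 0 + Σ≤ d (λ j → term (suc j))            ≈⟨ +-congˡ (Σ-cong d (λ j _ → split j)) ⟩
    u 0 + Σ≤ d (λ j → - u j + u (suc j))       ≈⟨ +-congˡ (Σ-telescope d u) ⟩
    u 0 + (- u 0 + u (suc d))                  ≈⟨ +-congˡ (+-congˡ last≈0) ⟩
    u 0 + (- u 0 + 0#)                         ≈⟨ +-congˡ (+-identityʳ _) ⟩
    u 0 + - u 0                                ≈⟨ -‿inverseʳ _ ⟩
    0#                                         ∎
    where
    term : ℕ → Carrier
    term j = sign j * ι (p ℕ.^ triangle j ℕ.* qbinom (suc d) j)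
    u : ℕ → Carrier
    u j = sign j * ι (weight d j)
    split : ∀ j → term (suc j) ≈ - u j + u (suc j)
    split j = begin
      term (suc j)                                        ≈⟨ *-congˡ (reflexive (≡.cong ι (weight-pascal d j))) ⟩
      sign (suc j) * ι (weight d j ℕ.+ weight d (suc j))  ≈⟨ *-congˡ (ι-+ (weight d j) (weight d (suc j))) ⟩
      sign (suc j) * (ι (weight d j) + ι (weight d (suc j)))  ≈⟨ distribˡ _ _ _ ⟩
      sign (suc j) * ι (weight d j) + u (suc j)           ≈⟨ +-congʳ (sign-suc j _) ⟩
      - u j + u (suc j)                                   ∎
    last≈0 : u (suc d) ≈ 0#
    last≈0 = trans (*-congˡ (reflexive (≡.cong ι vanish))) (zeroʳ _)
      where
      vanish : weight d (suc d) ≡.≡ 0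
      vanish = ≡.trans (≡.cong (λ g → p ℕ.^ triangle (suc d) ℕ.* (p ℕ.^ suc d ℕ.* g)) (qbinom-vanish (ℕₚ.n<1+n d)))
                       (≡.trans (≡.cong (p ℕ.^ triangle (suc d) ℕ.*_) (ℕₚ.*-zeroʳ (p ℕ.^ suc d))) (ℕₚ.*-zeroʳ (p ℕ.^ triangle (suc d))))

  alternating-pos : ∀ {d} → 0 ℕ.< d → alternating d ≈ 0#
  alternating-pos {suc d} _ = alternating-suc d

  -- The formula defining T' from T̃, applied to an arbitrary sequence X.
  dual : (ℕ → Carrier) → ℕ → Carrier
  dual X j = Σ≤ j (λ s → sign s * ι (p ℕ.^ triangle s) * ι (β p (n ∸ j ℕ.+ s) s) * X (j ∸ s))

  module _ (X : ℕ → Carrier) (r : ℕ) (r≤n : r ≤ n) where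

    outer : ℕ → ℕ
    outer q = β p (n ∸ q) (r ∸ q)

    inner : ℕ → ℕ → Carrier
    inner q s = sign s * ι (p ℕ.^ triangle s) * ι (β p (n ∸ q ℕ.+ s) s)

    -- The contribution of X_m through q = m + s.
    contribution : ℕ → ℕ → Carrier
    contribution m s = ι (outer (m ℕ.+ s)) * (inner (m ℕ.+ s) s * X m)

    outer-dual : ∀ q → ι (outer q) * dual X q ≈ Σ≤ q (λ s → contribution (q ∸ s) s)
    outer-dual q = trans (Σ-*ˡ q _ _) (Σ-cong q (λ s s≤q →
      reflexive (≡.cong (λ t → ι (outer t) * (inner t s * X (q ∸ s))) (≡.sym (ℕₚ.m∸n+n≡m s≤q)))))

    scalar : ∀ m s → s ≤ r ∸ m →
      ι (outer (m ℕ.+ s)) * inner (m ℕ.+ s) s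
        ≈ ι (qbinom (n ∸ m) (r ∸ m)) * (sign s * ι (p ℕ.^ triangle s ℕ.* qbinom (r ∸ m) s))
    scalar m s s≤d = begin
      ι B * ((sign s * ι P) * ι β′)       ≈⟨ *-congˡ (*-assoc _ _ _) ⟩
      ι B * (sign s * (ι P * ι β′))       ≈⟨ *-congˡ (*-congˡ (sym (ι-* P β′))) ⟩
      ι B * (sign s * ι (P ℕ.* β′))       ≈⟨ ι-into-signed B s (P ℕ.* β′) ⟩
      sign s * ι (B ℕ.* (P ℕ.* β′))       ≈⟨ *-congˡ (reflexive (≡.cong ι product)) ⟩
      sign s * ι (qbinom a d ℕ.* (P ℕ.* qbinom d s))   ≈⟨ sym (ι-into-signed (qbinom a d) s _) ⟩
      ι (qbinom a d) * (sign s * ι (P ℕ.* qbinom d s)) ∎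
      where
      a = n ∸ m
      d = r ∸ m
      B = outer (m ℕ.+ s)
      P = p ℕ.^ triangle s
      β′ = β p (n ∸ (m ℕ.+ s) ℕ.+ s) s
      product : B ℕ.* (P ℕ.* β′) ≡.≡ qbinom a d ℕ.* (P ℕ.* qbinom d s)
      product = ≡.trans
        (≡.cong₂ (λ u v → β p u v ℕ.* (P ℕ.* β p (u ℕ.+ s) s))
                 (≡.sym (ℕₚ.∸-+-assoc n m s)) (≡.sym (ℕₚ.∸-+-assoc r m s)))
        (β-product s≤d (ℕₚ.∸-monoˡ-≤ m r≤n) P)

    coefficient : ∀ m → Σ≤ (r ∸ m) (contribution m) ≈ (ι (qbinom (n ∸ m) (r ∸ m)) * alternating (r ∸ m)) * X m
    coefficient m = begin
      Σ≤ d (contribution m)                                              ≈⟨ Σ-cong d (λ s _ → sym (*-assoc _ _ _)) ⟩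
      Σ≤ d (λ s → (ι (outer (m ℕ.+ s)) * inner (m ℕ.+ s) s) * X m)       ≈⟨ sym (Σ-*ʳ d (X m) _) ⟩
      Σ≤ d (λ s → ι (outer (m ℕ.+ s)) * inner (m ℕ.+ s) s) * X m         ≈⟨ *-congʳ (Σ-cong d (scalar m)) ⟩
      Σ≤ d (λ s → ι (qbinom (n ∸ m) d) * (sign s * ι (p ℕ.^ triangle s ℕ.* qbinom d s))) * X m
                                                                         ≈⟨ *-congʳ (sym (Σ-*ˡ d _ _)) ⟩
      (ι (qbinom (n ∸ m) d) * alternating d) * X m                       ∎
      where
      d = r ∸ m

    inversion : Σ≤ r (λ q → ι (outer q) * dual X q) ≈ X r
    inversion = begin
      Σ≤ r (λ q → ι (outer q) * dual X q)                  ≈⟨ Σ-cong r (λ q _ → outer-dual q) ⟩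
      Σ≤ r (λ q → Σ≤ q (λ s → contribution (q ∸ s) s))    ≈⟨ antidiagonal r contribution ⟩
      Σ≤ r (λ m → Σ≤ (r ∸ m) (contribution m))            ≈⟨ Σ-cong r (λ m _ → coefficient m) ⟩
      Σ≤ r (λ m → κ m * X m)                               ≈⟨ Σ-last r _ (λ m m<r → trans (*-congʳ (κ-vanish m<r)) (zeroˡ _)) ⟩
      κ r * X r                                            ≈⟨ *-congʳ κ-last ⟩
      1# * X r                                             ≈⟨ *-identityˡ _ ⟩
      X r                                                  ∎
      where
      κ : ℕ → Carrier
      κ m = ι (qbinom (n ∸ m) (r ∸ m)) * alternating (r ∸ m)
      κ-vanish : ∀ {m} → m ℕ.< r → κ m ≈ 0#
      κ-vanish m<r = trans (*-congˡ (alternating-pos (ℕₚ.m<n⇒0<n∸m m<r))) (zeroʳ _)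
      κ-last : κ r ≈ 1#
      κ-last = trans (reflexive (≡.cong (λ t → ι (qbinom (n ∸ r) t) * alternating t) (ℕₚ.n∸n≡0 r)))
                     (trans (*-cong (+-identityʳ 1#) alternating-zero) (*-identityˡ 1#))

proposition3p2 : ∀ {c ℓ} (R : Ring c ℓ) → let open Ring R in let open RingOps R in
    (p k n N : ℕ) → Prime p → 1 ≤ k → 1 ≤ n → 1 ≤ N → ¬ (p ∣ N) →
    (P Pinv : Carrier) → P ≈ ι p → P * Pinv ≈ 1# → Pinv * P ≈ 1# →
    (T : ℕ → Carrier) → T 0 ≈ 1# →
    (r : ℕ) → 1 ≤ r → r ≤ n →
    Ttilde p k n P Pinv T r
      ≈ Σ≤ r (λ q → ι (β p (n ∸ q) (r ∸ q)) * T′ p k n P Pinv T q)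
proposition3p2 R p k n N p-prime _ _ _ _ P Pinv _ _ _ T _ r _ r≤n =
  Ring.sym R (Inversion.inversion R p n 1<p (RingOps.Ttilde R p k n P Pinv T) r r≤n)
  where
  1<p : 1 ℕ.< p
  1<p = ℕ.nonTrivial⇒n>1 p {{prime⇒nonTrivial p-prime}}
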